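{- Let $q=2$, $1<k<n-1$, $V=\mathbb{F}_2^n$, and let $S$ be a $(k-1)$-dimensional subspace of $V$. Let $c(S)$ be the number of coordinate hyperplanes $C_i$ containing $S$. Then the set $[S\rangle^c_k$ of all non-degenerate $k$-dimensional subspaces of $V$ containing $S$ is a maximal clique of the graph $\Gamma(n,k)_2$ if and only if $c(S)\le n-k-1$.
   Context: $C_i=\{x\in V: x_i=0\}$ for $i=1,\dots,n$. A $k$-dimensional subspace is non-degenerate if it is not contained in any $C_i$; $\mathcal{C}(n,k)_2$ is the set of such subspaces. $\Gamma(n,k)_2$ is the graph on $\mathcal{C}(n,k)_2$ where two vertices are adjacent iff their intersection is $(k-1)$-dimensional. -}

module Defs where

open import Data.Bool using (Bool; true; false; not; _∧_; _∨_; _xor_)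
open import Data.Nat using (ℕ; zero; suc; _∸_)
open import Data.Fin using (Fin)
open import Data.Vec using (Vec; []; _∷_; lookup; replicate; zipWith)
open import Data.List using (List; [_]; map; _++_; foldr; filterᵇ; length; allFin)
open import Data.Product using (Σ; _×_; ∃)
open import Relation.Binary.PropositionalEquality using (_≡_)
open import Relation.Nullary using (¬_)
open import Function.Bundles using (_⇔_)

-- V = F₂ⁿ, vectors as Vec Bool n (true = 1, false = 0); addition is xor.
V : ℕ → Set
V n = Vec Bool n

zeroV : ∀ {n} → V n
zeroV = replicate _ false

_⊕_ : ∀ {n} → V n → V n → V n
_⊕_ = zipWith _xor_

allVecs : (n : ℕ) → List (V n)
allVecs zero = [ [] ]
allVecs (suc n) = map (true ∷_) (allVecs n) ++ map (false ∷_) (allVecs n)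

Sub : ℕ → Set
Sub n = V n → Bool

_∈ₛ_ : ∀ {n} → V n → Sub n → Set
x ∈ₛ U = U x ≡ true

_⊆ₛ_ : ∀ {n} → Sub n → Sub n → Set
U ⊆ₛ W = ∀ x → x ∈ₛ U → x ∈ₛ W

_≐_ : ∀ {n} → Sub n → Sub n → Set
U ≐ W = ∀ x → U x ≡ W x

_∩ₛ_ : ∀ {n} → Sub n → Sub n → Sub n
(U ∩ₛ W) x = U x ∧ W x

C : ∀ {n} → Fin n → Sub n
C i x = not (lookup x i)

lincomb : ∀ {n k} → Vec Bool k → Vec (V n) k → V n
lincomb [] [] = zeroV
lincomb (c ∷ cs) (v ∷ vs) = if c then v ⊕ lincomb cs vs else lincomb cs vs
  where open import Data.Bool using (if_then_else_)

InSpan : ∀ {n k} → Vec (V n) k → V n → Set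
InSpan b x = ∃ λ c → lincomb c b ≡ x

LinIndep : ∀ {n k} → Vec (V n) k → Set
LinIndep {k = k} b = ∀ c → lincomb c b ≡ zeroV → c ≡ replicate k false

HasDim : ∀ {n} → Sub n → ℕ → Set
HasDim {n} U k = Σ (Vec (V n) k) λ b → LinIndep b × (∀ x → (x ∈ₛ U) ⇔ InSpan b x)

NonDeg : ∀ {n} → Sub n → Set
NonDeg {n} U = ∀ (i : Fin n) → ¬ (U ⊆ₛ C i)

Vertex : ∀ {n} → ℕ → Sub n → Set
Vertex k U = HasDim U k × NonDeg U

Adj : ∀ {n} → ℕ → Sub n → Sub n → Set
Adj k U W = HasDim (U ∩ₛ W) (k ∸ 1)

IsClique : ∀ {n} → ℕ → (Sub n → Set) → Set
IsClique {n} k P = ∀ (U W : Sub n) → P U → P W → ¬ (U ≐ W) → Adj k U W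

IsMaximalClique : ∀ {n} → ℕ → (Sub n → Set) → Set
IsMaximalClique {n} k P =
  IsClique k P ×
  ¬ (Σ (Sub n) λ W → Vertex k W × ¬ P W × (∀ U → P U → Adj k U W))

Star : ∀ {n} → Sub n → ℕ → Sub n → Set
Star S k U = Vertex k U × S ⊆ₛ U

containedᵇ : ∀ {n} → Sub n → Fin n → Bool
containedᵇ {n} S i = foldr (λ x r → (not (S x) ∨ C i x) ∧ r) true (allVecs n)

c : ∀ {n} → Sub n → ℕ
c {n} S = length (filterᵇ (containedᵇ S) (allFin n))

-- Let D be the set of coordinates i with S ⊆ Cᵢ (so c(S) = |D|) and Z = ⋂_{i ∈ D} Cᵢ, a coordinate
-- subspace of dimension N = n - c(S) containing S; the condition c(S) ≤ n - k - 1 says N ≥ k + 1.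
-- The members of [S⟩ᶜ_k are the spaces ⟨u, S⟩ with u ∉ S and uᵢ = 1 for every i ∈ D, and two of them
-- can only share a vector outside S by being equal, so the star is a clique. A vertex W outside the
-- star adjacent to all of it does not contain S, hence meets each member ⟨u, S⟩ in a vector outside S.
-- If N ≥ k + 1 there are three members ⟨vⱼ, S⟩ with v₁, v₂, v₃ independent modulo S (𝟙 and 𝟙 + y for
-- y ∈ Z, or vectors of Z = V when D = ∅, using n ≥ k + 2), and W would contain k + 1 independent
-- vectors. If N ≤ k then D ≠ ∅, and there is w ∉ ⟨𝟙, S⟩ with Z ⊆ ⟨w, S⟩; writing S = ⟨s₁, r⟩, the
-- space W = ⟨𝟙, w, r⟩ is non-degenerate, misses s₁, and meets every member ⟨u, S⟩ in ⟨𝟙 + εw, r⟩,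
-- where u + 𝟙 ∈ Z ⊆ ⟨w, S⟩ has w-coefficient ε.

module Submission where

open import Defs
open import Data.Nat using (ℕ; zero; suc; _<_; _≤_; _∸_; _+_; _^_; z≤n; s≤s)
open import Data.Nat.Properties
  using (≤-refl; ≤-trans; <⇒≤; ≤-pred; ≰⇒>; _≤?_; n≤1+n; 1+n≰n; ≮⇒≥; <⇒≱; ^-monoʳ-<;
         +-suc; +-comm; ∸-+-assoc; +-cancelˡ-≤; +-monoʳ-≤; m≤o∸n⇒m+n≤o; m+n≤o⇒m≤o∸n)
open import Data.Bool using (Bool; true; false; not; _∧_; _∨_; _xor_; if_then_else_; _≟_)
open import Data.Bool.Properties
  using (not-injective; xor-assoc; xor-comm; xor-same; xor-identityˡ; xor-identityʳ)
open import Data.Fin using (Fin; zero; suc)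
open import Data.Fin.Properties using (all?; any?; ¬∀⟶∃¬; injective⇒≤; 2↔Bool; *↔×)
open import Data.Vec using (Vec; []; _∷_; lookup; replicate)
open import Data.Vec.Properties
  using (zipWith-assoc; zipWith-comm; zipWith-identityˡ; zipWith-identityʳ;
         lookup-zipWith; lookup-replicate; lookup-map; ∷-injectiveʳ; ≡-dec)
open import Data.List using (List; []; _∷_; length; filterᵇ; tabulate; foldr)
open import Data.List.Membership.Propositional using (_∈_)
open import Data.List.Membership.Propositional.Properties using (∈-++⁺ˡ; ∈-++⁺ʳ; ∈-map⁺)
open import Data.List.Relation.Unary.Any using (here; there)
open import Data.Product using (∃; _×_; _,_; proj₁; proj₂)
open import Data.Product.Function.NonDependent.Propositional using (_×-↔_)
open import Data.Sum using (_⊎_; inj₁; inj₂)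
open import Data.Empty using (⊥; ⊥-elim)
open import Function using (_∘_)
open import Function.Bundles using (_⇔_; mk⇔; Equivalence; _↔_; mk↔ₛ′; Injection; _↣_)
open import Function.Construct.Composition using (_⇔-∘_)
open import Function.Construct.Symmetry using (⇔-sym)
open import Function.Properties.Inverse using (↔-sym; ↔-trans; ↔⇒↣)
open import Relation.Binary.PropositionalEquality
open import Relation.Nullary using (¬_; Dec; yes; no; does; contradiction)

open Equivalence using (to; from)

private
  variable
    n k l m : ℕ

-- Vector arithmetic over F₂

⊕-assoc : (x y z : V n) → (x ⊕ y) ⊕ z ≡ x ⊕ (y ⊕ z)
⊕-assoc = zipWith-assoc xor-assoc

⊕-comm : (x y : V n) → x ⊕ y ≡ y ⊕ x
⊕-comm = zipWith-comm xor-comm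

⊕-identityˡ : (x : V n) → zeroV ⊕ x ≡ x
⊕-identityˡ = zipWith-identityˡ xor-identityˡ

⊕-identityʳ : (x : V n) → x ⊕ zeroV ≡ x
⊕-identityʳ = zipWith-identityʳ xor-identityʳ

⊕-self : (x : V n) → x ⊕ x ≡ zeroV
⊕-self []      = refl
⊕-self (a ∷ x) = cong₂ _∷_ (xor-same a) (⊕-self x)

⊕-cancelˡ : (x y : V n) → x ⊕ (x ⊕ y) ≡ y
⊕-cancelˡ x y = begin
  x ⊕ (x ⊕ y) ≡⟨ ⊕-assoc x x y ⟨
  (x ⊕ x) ⊕ y ≡⟨ cong (_⊕ y) (⊕-self x) ⟩
  zeroV ⊕ y   ≡⟨ ⊕-identityˡ y ⟩
  y           ∎
  where open ≡-Reasoning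

⊕-cancelʳ : (x y : V n) → (x ⊕ y) ⊕ y ≡ x
⊕-cancelʳ x y = trans (⊕-comm (x ⊕ y) y) (trans (cong (y ⊕_) (⊕-comm x y)) (⊕-cancelˡ y x))

⊕-interchange : (a b c d : V n) → (a ⊕ b) ⊕ (c ⊕ d) ≡ (a ⊕ c) ⊕ (b ⊕ d)
⊕-interchange a b c d = begin
  (a ⊕ b) ⊕ (c ⊕ d) ≡⟨ ⊕-assoc a b (c ⊕ d) ⟩
  a ⊕ (b ⊕ (c ⊕ d)) ≡⟨ cong (a ⊕_) (⊕-assoc b c d) ⟨
  a ⊕ ((b ⊕ c) ⊕ d) ≡⟨ cong (λ t → a ⊕ (t ⊕ d)) (⊕-comm b c) ⟩
  a ⊕ ((c ⊕ b) ⊕ d) ≡⟨ cong (a ⊕_) (⊕-assoc c b d) ⟩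
  a ⊕ (c ⊕ (b ⊕ d)) ≡⟨ ⊕-assoc a c (b ⊕ d) ⟨
  (a ⊕ c) ⊕ (b ⊕ d) ∎
  where open ≡-Reasoning

lookup-⊕ : (x y : V n) (i : Fin n) → lookup (x ⊕ y) i ≡ lookup x i xor lookup y i
lookup-⊕ x y i = lookup-zipWith _xor_ i x y

scale : Bool → V n → V n
scale c v = if c then v else zeroV

scale-xor : (c d : Bool) (v : V n) → scale (c xor d) v ≡ scale c v ⊕ scale d v
scale-xor true  true  v = sym (⊕-self v)
scale-xor true  false v = sym (⊕-identityʳ v)
scale-xor false d     v = sym (⊕-identityˡ (scale d v))

lincomb-∷ : (c : Bool) (cs : Vec Bool k) (v : V n) (vs : Vec (V n) k) →
  lincomb (c ∷ cs) (v ∷ vs) ≡ scale c v ⊕ lincomb cs vs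
lincomb-∷ true  cs v vs = refl
lincomb-∷ false cs v vs = sym (⊕-identityˡ _)

lincomb-zero : (b : Vec (V n) k) → lincomb (replicate k false) b ≡ zeroV
lincomb-zero []      = refl
lincomb-zero (v ∷ b) = lincomb-zero b

lincomb-⊕ : (c d : Vec Bool k) (b : Vec (V n) k) →
  lincomb (c ⊕ d) b ≡ lincomb c b ⊕ lincomb d b
lincomb-⊕ []       []       []       = sym (⊕-self zeroV)
lincomb-⊕ (c ∷ cs) (d ∷ ds) (v ∷ vs) = begin
  lincomb ((c xor d) ∷ (cs ⊕ ds)) (v ∷ vs)
    ≡⟨ lincomb-∷ (c xor d) (cs ⊕ ds) v vs ⟩
  scale (c xor d) v ⊕ lincomb (cs ⊕ ds) vs
    ≡⟨ cong₂ _⊕_ (scale-xor c d v) (lincomb-⊕ cs ds vs) ⟩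
  (scale c v ⊕ scale d v) ⊕ (lincomb cs vs ⊕ lincomb ds vs)
    ≡⟨ ⊕-interchange _ _ _ _ ⟩
  (scale c v ⊕ lincomb cs vs) ⊕ (scale d v ⊕ lincomb ds vs)
    ≡⟨ cong₂ _⊕_ (lincomb-∷ c cs v vs) (lincomb-∷ d ds v vs) ⟨
  lincomb (c ∷ cs) (v ∷ vs) ⊕ lincomb (d ∷ ds) (v ∷ vs) ∎
  where open ≡-Reasoning

lincomb-injective : {b : Vec (V n) k} → LinIndep b → ∀ c d → lincomb c b ≡ lincomb d b → c ≡ d
lincomb-injective {b = b} ind c d eq = begin
  c           ≡⟨ ⊕-identityʳ c ⟨
  c ⊕ zeroV   ≡⟨ cong (c ⊕_) (ind (c ⊕ d) lincomb-c⊕d≡0) ⟨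
  c ⊕ (c ⊕ d) ≡⟨ ⊕-cancelˡ c d ⟩
  d           ∎
  where
  open ≡-Reasoning
  lincomb-c⊕d≡0 : lincomb (c ⊕ d) b ≡ zeroV
  lincomb-c⊕d≡0 = trans (lincomb-⊕ c d b) (trans (cong (_⊕ lincomb d b) eq) (⊕-self _))

∧-true⁻ : {a b : Bool} → a ∧ b ≡ true → a ≡ true × b ≡ true
∧-true⁻ {true} {true} _ = refl , refl

∧-true⁺ : {a b : Bool} → a ≡ true → b ≡ true → a ∧ b ≡ true
∧-true⁺ refl refl = refl

Spans : Vec (V n) k → Sub n → Set
Spans b U = ∀ x → (x ∈ₛ U) ⇔ InSpan b x

infix 4 _⊑_

_⊑_ : Vec (V n) k → Vec (V n) l → Set
b ⊑ b′ = ∀ j → InSpan b′ (lookup b j)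

span-zero : (b : Vec (V n) k) → InSpan b zeroV
span-zero {k = k} b = replicate k false , lincomb-zero b

span-⊕ : {b : Vec (V n) k} {x y : V n} → InSpan b x → InSpan b y → InSpan b (x ⊕ y)
span-⊕ {b = b} (c , refl) (d , refl) = c ⊕ d , lincomb-⊕ c d b

span-here : (x : V n) (b : Vec (V n) k) → InSpan (x ∷ b) x
span-here {k = k} x b = true ∷ replicate k false , trans (cong (x ⊕_) (lincomb-zero b)) (⊕-identityʳ x)

span-there : {x : V n} {b : Vec (V n) k} {y : V n} → InSpan b y → InSpan (x ∷ b) y
span-there (c , eq) = false ∷ c , eq

span-skip : {x y : V n} {b : Vec (V n) k} {z : V n} → InSpan (x ∷ b) z → InSpan (x ∷ y ∷ b) z
span-skip (c ∷ cs , eq) = c ∷ false ∷ cs , eq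

∉-span-⊕ : {b : Vec (V n) k} {x y : V n} → InSpan b x → ¬ InSpan b y → ¬ InSpan b (x ⊕ y)
∉-span-⊕ {x = x} {y} x∈b y∉b x⊕y∈b =
  y∉b (subst (InSpan _) (⊕-cancelˡ x y) (span-⊕ x∈b x⊕y∈b))

span-scale-here : (c : Bool) (v : V n) (b : Vec (V n) k) → InSpan (v ∷ b) (scale c v)
span-scale-here true  v b = span-here v b
span-scale-here false v b = span-there (span-zero b)

⊑-refl : (b : Vec (V n) k) → b ⊑ b
⊑-refl (v ∷ b) zero    = span-here v b
⊑-refl (v ∷ b) (suc j) = span-there (⊑-refl b j)

⊑-there : {b : Vec (V n) k} {b′ : Vec (V n) l} {x : V n} → b ⊑ b′ → b ⊑ x ∷ b′
⊑-there b⊑b′ j = span-there (b⊑b′ j)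

⊑-∷ : {x : V n} {b : Vec (V n) k} {b′ : Vec (V n) l} → InSpan b′ x → b ⊑ b′ → x ∷ b ⊑ b′
⊑-∷ x∈b′ b⊑b′ zero    = x∈b′
⊑-∷ x∈b′ b⊑b′ (suc j) = b⊑b′ j

span-mono : {b : Vec (V n) k} {b′ : Vec (V n) l} → b ⊑ b′ → {y : V n} → InSpan b y → InSpan b′ y
span-mono {b = []}    {b′} _ ([] , refl) = span-zero b′
span-mono {b = v ∷ b} b⊑b′ (true ∷ c , refl) =
  span-⊕ (b⊑b′ zero) (span-mono (λ j → b⊑b′ (suc j)) (c , refl))
span-mono {b = v ∷ b} b⊑b′ (false ∷ c , refl) = span-mono (λ j → b⊑b′ (suc j)) (c , refl)

InSpan? : (b : Vec (V n) k) (x : V n) → Dec (InSpan b x)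
InSpan? [] x with ≡-dec _≟_ zeroV x
... | yes eq = yes ([] , eq)
... | no ne  = no λ { ([] , eq) → ne eq }
InSpan? (v ∷ b) x with InSpan? b x | InSpan? b (v ⊕ x)
... | yes (c , eq) | _            = yes (false ∷ c , eq)
... | no _         | yes (c , eq) = yes (true ∷ c , trans (cong (v ⊕_) eq) (⊕-cancelˡ v x))
... | no x∉b       | no v⊕x∉b     = no λ
  { (false ∷ c , eq) → x∉b (c , eq)
  ; (true ∷ c , eq)  → v⊕x∉b (c , trans (sym (⊕-cancelˡ v _)) (cong (v ⊕_) eq)) }

spanᵇ : Vec (V n) k → Sub n
spanᵇ b x = does (InSpan? b x)

spanᵇ-spans : (b : Vec (V n) k) → Spans b (spanᵇ b)
spanᵇ-spans b x with InSpan? b x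
... | yes x∈b = mk⇔ (λ _ → x∈b) (λ _ → refl)
... | no x∉b  = mk⇔ (λ ()) (λ x∈b → contradiction x∈b x∉b)

spanᵇ-hasDim : (b : Vec (V n) k) → LinIndep b → HasDim (spanᵇ b) k
spanᵇ-hasDim b ind = b , ind , spanᵇ-spans b

spans-unique : {b : Vec (V n) k} {U W : Sub n} → Spans b U → Spans b W → U ≐ W
spans-unique {U = U} {W} U≡b W≡b x with U x in Ux | W x in Wx
... | true  | true  = refl
... | false | false = refl
... | true  | false = sym (trans (sym Wx) (from (W≡b x) (to (U≡b x) Ux)))
... | false | true  = trans (sym Ux) (from (U≡b x) (to (W≡b x) Wx))

indep-tail : {x : V n} {b : Vec (V n) k} → LinIndep (x ∷ b) → LinIndep b
indep-tail ind c eq = ∷-injectiveʳ (ind (false ∷ c) eq)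

indep-head : {x : V n} {b : Vec (V n) k} → LinIndep (x ∷ b) → ¬ InSpan b x
indep-head {x = x} ind (c , eq) with ind (true ∷ c) (trans (cong (x ⊕_) eq) (⊕-self x))
... | ()

indep-∷ : {x : V n} {b : Vec (V n) k} → ¬ InSpan b x → LinIndep b → LinIndep (x ∷ b)
indep-∷ {x = x} {b} x∉b ind (true ∷ c) eq =
  ⊥-elim (x∉b (c , trans (sym (⊕-cancelˡ x _)) (trans (cong (x ⊕_) eq) (⊕-identityʳ x))))
indep-∷ x∉b ind (false ∷ c) eq = cong (false ∷_) (ind c eq)

indep-skip : {x y : V n} {b : Vec (V n) k} → LinIndep (x ∷ y ∷ b) → LinIndep (x ∷ b)
indep-skip ind (c ∷ cs) eq with ind (c ∷ false ∷ cs) eq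
... | refl = refl

indep-⊕-head : {x y : V n} {b : Vec (V n) k} → LinIndep (x ∷ b) → InSpan b y → LinIndep ((x ⊕ y) ∷ b)
indep-⊕-head {x = x} {y} ind y∈b = indep-∷ x⊕y∉b (indep-tail ind)
  where
  x⊕y∉b : ¬ InSpan _ (x ⊕ y)
  x⊕y∉b x⊕y∈b = indep-head ind (subst (InSpan _) (⊕-cancelʳ x y) (span-⊕ x⊕y∈b y∈b))

span-exchange : {x y : V n} {b : Vec (V n) k} → InSpan (y ∷ b) x → ¬ InSpan b x → InSpan (x ∷ b) y
span-exchange (false ∷ c , eq) x∉b = contradiction (c , eq) x∉b
span-exchange {x = x} {y} {b} (true ∷ c , eq) x∉b = true ∷ c , (begin
  x ⊕ lincomb c b                 ≡⟨ cong (_⊕ lincomb c b) eq ⟨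
  (y ⊕ lincomb c b) ⊕ lincomb c b ≡⟨ ⊕-cancelʳ y _ ⟩
  y                               ∎)
  where open ≡-Reasoning

∉-span-exchange : {x v : V n} {b : Vec (V n) k} {t : Vec (V n) l} →
  InSpan (v ∷ b) x → ¬ InSpan b x → ¬ InSpan t v → b ⊑ t → ¬ InSpan t x
∉-span-exchange x∈vb x∉b v∉t b⊑t x∈t =
  v∉t (span-mono (⊑-∷ x∈t b⊑t) (span-exchange x∈vb x∉b))

span-∩ : {z p q : V n} {b : Vec (V n) k} → LinIndep (z ∷ p ∷ q ∷ b) →
  {x : V n} → InSpan (z ∷ p ∷ b) x → InSpan (z ∷ q ∷ b) x → InSpan (z ∷ b) x
span-∩ ind (c ∷ false ∷ cs , eq) _ = c ∷ cs , eq
span-∩ ind (c ∷ true ∷ cs , eq) (d ∷ e ∷ ds , eq′)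
  with lincomb-injective ind (c ∷ true ∷ false ∷ cs) (d ∷ false ∷ e ∷ ds) (trans eq (sym eq′))
... | ()

-- xᵢ ∈ ⟨vᵢ, b⟩ ∖ ⟨b⟩ forces vᵢ ∈ ⟨xᵢ, b⟩, so a dependency would put some vᵢ in the span
-- of the later ones.
indep-from-exchange : {v₁ v₂ v₃ x₁ x₂ : V n} {b : Vec (V n) k} {β : Vec (V n) l} →
  LinIndep (v₁ ∷ v₂ ∷ v₃ ∷ b) →
  InSpan (v₁ ∷ b) x₁ → ¬ InSpan b x₁ → InSpan (v₂ ∷ b) x₂ → ¬ InSpan b x₂ →
  LinIndep β → β ⊑ v₃ ∷ b → LinIndep (x₁ ∷ x₂ ∷ β)
indep-from-exchange {x₁ = x₁} {x₂} {b} {β} ind x₁∈v₁b x₁∉b x₂∈v₂b x₂∉b β-indep β⊑v₃b =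
  indep-∷ x₁∉x₂β (indep-∷ x₂∉β β-indep)
  where
  x₂∉β : ¬ InSpan β x₂
  x₂∉β = ∉-span-exchange x₂∈v₂b x₂∉b (indep-head (indep-tail ind)) (⊑-there {b = b} (⊑-refl b))
       ∘ span-mono β⊑v₃b
  x₁∉x₂β : ¬ InSpan (x₂ ∷ β) x₁
  x₁∉x₂β = ∉-span-exchange x₁∈v₁b x₁∉b (indep-head ind)
             (⊑-there {b = b} (⊑-there {b = b} (⊑-refl b)))
         ∘ span-mono (⊑-∷ (span-skip x₂∈v₂b) (⊑-there {b = β} β⊑v₃b))

-- Dimension

Vec-uncons↔ : {A : Set} → Vec A (suc k) ↔ (A × Vec A k)
Vec-uncons↔ =
  mk↔ₛ′ (λ { (x ∷ xs) → x , xs }) (λ (x , xs) → x ∷ xs) (λ _ → refl) (λ { (x ∷ xs) → refl })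

Vec-Bool↔Fin : ∀ k → Vec Bool k ↔ Fin (2 ^ k)
Vec-Bool↔Fin zero    = mk↔ₛ′ (λ _ → zero) (λ _ → []) (λ { zero → refl }) (λ { [] → refl })
Vec-Bool↔Fin (suc k) =
  ↔-trans Vec-uncons↔ (↔-trans (↔-sym 2↔Bool ×-↔ Vec-Bool↔Fin k) (↔-sym *↔×))

-- Pigeonhole: c ↦ (coefficients of lincomb c w over b) is an injection of 2^k into 2^l.
indep-length-≤ : {w : Vec (V n) k} {b : Vec (V n) l} → LinIndep w → w ⊑ b → k ≤ l
indep-length-≤ {k = k} {l} {w} {b} ind w⊑b = ≮⇒≥ λ l<k →
  <⇒≱ (^-monoʳ-< 2 (s≤s (s≤s z≤n)) l<k)
      (injective⇒≤ (injective fromFin ∘ coeffs-injective _ _ ∘ injective toFin))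
  where
  open Injection using (injective)
  fromFin : Fin (2 ^ k) ↣ Vec Bool k
  fromFin = ↔⇒↣ (↔-sym (Vec-Bool↔Fin k))
  toFin : Vec Bool l ↣ Fin (2 ^ l)
  toFin = ↔⇒↣ (Vec-Bool↔Fin l)
  lincomb-in-b : (c : Vec Bool k) → InSpan b (lincomb c w)
  lincomb-in-b c = span-mono w⊑b (c , refl)
  coeffs : Vec Bool k → Vec Bool l
  coeffs c = proj₁ (lincomb-in-b c)
  coeffs-injective : ∀ c d → coeffs c ≡ coeffs d → c ≡ d
  coeffs-injective c d eq = lincomb-injective ind c d (begin
    lincomb c w          ≡⟨ proj₂ (lincomb-in-b c) ⟨
    lincomb (coeffs c) b ≡⟨ cong (λ e → lincomb e b) eq ⟩
    lincomb (coeffs d) b ≡⟨ proj₂ (lincomb-in-b d) ⟩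
    lincomb d w          ∎)
    where open ≡-Reasoning

⊑-or-outside : (t : Vec (V n) k) (b : Vec (V n) l) → t ⊑ b ⊎ ∃ λ j → ¬ InSpan b (lookup t j)
⊑-or-outside {k = k} t b with all? (λ j → InSpan? b (lookup t j))
... | yes t⊑b = inj₁ t⊑b
... | no t⋢b  = inj₂ (¬∀⟶∃¬ k _ (λ j → InSpan? b (lookup t j)) t⋢b)

indep-⊑-flip : {g : Vec (V n) k} {t : Vec (V n) l} → k ≤ l → LinIndep t → t ⊑ g → g ⊑ t
indep-⊑-flip {g = g} {t} k≤l ind t⊑g j with InSpan? t (lookup g j)
... | yes g[j]∈t = g[j]∈t
... | no g[j]∉t  =
  contradiction (indep-length-≤ (indep-∷ g[j]∉t ind) (⊑-∷ (⊑-refl g j) t⊑g)) (<⇒≱ (s≤s k≤l))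

∃-outside-span : (F : Vec (V n) k) (b : Vec (V n) l) → l < k → LinIndep F →
  ∃ λ j → ¬ InSpan b (lookup F j)
∃-outside-span F b l<k ind with ⊑-or-outside F b
... | inj₁ F⊑b     = contradiction (indep-length-≤ ind F⊑b) (<⇒≱ l<k)
... | inj₂ outside = outside

extend-indep : {F : Vec (V n) k} {b : Vec (V n) l} → l < k → LinIndep F → LinIndep b →
  ∃ λ j → LinIndep (lookup F j ∷ b)
extend-indep {F = F} {b} l<k indF indb with ∃-outside-span F b l<k indF
... | j , F[j]∉b = j , indep-∷ F[j]∉b indb

indep-spans : {U : Sub n} {t : Vec (V n) l} → HasDim U k → k ≤ l → LinIndep t →
  (∀ j → lookup t j ∈ₛ U) → Spans t U
indep-spans {t = t} (β , indβ , β-spans) k≤l indt t⊆U x = mk⇔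
  (λ x∈U → span-mono β⊑t (to (β-spans x) x∈U))
  (λ x∈t → from (β-spans x) (span-mono t⊑β x∈t))
  where
  t⊑β : t ⊑ β
  t⊑β j = to (β-spans _) (t⊆U j)
  β⊑t : β ⊑ t
  β⊑t = indep-⊑-flip k≤l indt t⊑β

∃-∈-outside-span : {U : Sub n} → HasDim U k → (b : Vec (V n) l) → l < k →
  ∃ λ u → u ∈ₛ U × ¬ InSpan b u
∃-∈-outside-span (β , indβ , β-spans) b l<k with ∃-outside-span β b l<k indβ
... | j , β[j]∉b = lookup β j , from (β-spans _) (⊑-refl β j) , β[j]∉b

-- Coordinate subspaces

countᵇ : (Fin n → Bool) → ℕ
countᵇ {zero}  q = 0
countᵇ {suc n} q = if q zero then suc (countᵇ (q ∘ suc)) else countᵇ (q ∘ suc)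

VanishesOn : (Fin n → Bool) → V n → Set
VanishesOn q x = ∀ i → q i ≡ true → lookup x i ≡ false

record VanishingBasis (q : Fin n → Bool) (d : ℕ) : Set where
  field
    vectors     : Vec (V n) d
    independent : LinIndep vectors
    vanish      : ∀ j → VanishesOn q (lookup vectors j)
    complete    : ∀ x → VanishesOn q x → InSpan vectors x

lift : Vec (V n) k → Vec (V (suc n)) k
lift = Data.Vec.map (false ∷_)

lincomb-lift : (d : Vec Bool k) (F : Vec (V n) k) → lincomb d (lift F) ≡ false ∷ lincomb d F
lincomb-lift []          []      = refl
lincomb-lift (true ∷ d)  (v ∷ F) = cong ((false ∷ v) ⊕_) (lincomb-lift d F)
lincomb-lift (false ∷ d) (v ∷ F) = lincomb-lift d F

indep-lift : {F : Vec (V n) k} → LinIndep F → LinIndep (lift F)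
indep-lift {F = F} ind d eq = ind d (∷-injectiveʳ (trans (sym (lincomb-lift d F)) eq))

span-lift : {F : Vec (V n) k} {x : V n} → InSpan F x → InSpan (lift F) (false ∷ x)
span-lift {F = F} (c , refl) = c , lincomb-lift c F

vanishes-false∷ : {q : Fin (suc n) → Bool} {x : V n} →
  VanishesOn (q ∘ suc) x → VanishesOn q (false ∷ x)
vanishes-false∷ x-vanishes zero    _  = refl
vanishes-false∷ x-vanishes (suc i) qi = x-vanishes i qi

vanish-lift : {q : Fin (suc n) → Bool} (F : Vec (V n) k) →
  (∀ j → VanishesOn (q ∘ suc) (lookup F j)) → ∀ j → VanishesOn q (lookup (lift F) j)
vanish-lift F F-vanishes j =
  subst (VanishesOn _) (sym (lookup-map j (false ∷_) F)) (vanishes-false∷ (F-vanishes j))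

vanishing-basis : (q : Fin n → Bool) → VanishingBasis q (countᵇ (not ∘ q))
vanishing-basis {zero}  q = record
  { vectors = [] ; independent = λ { [] _ → refl } ; vanish = λ () ; complete = λ { [] _ → [] , refl } }
vanishing-basis {suc n} q with vanishing-basis (q ∘ suc) | q zero in q0
... | B | true = record
  { vectors     = lift vectors
  ; independent = indep-lift independent
  ; vanish      = vanish-lift vectors vanish
  ; complete    = λ { (x₀ ∷ x) x-vanishes → subst (λ b → InSpan (lift vectors) (b ∷ x))
                        (sym (x-vanishes zero q0)) (span-lift (complete x (x-vanishes ∘ suc))) }
  }
  where open VanishingBasis B
... | B | false = record
  { vectors     = e₀ ∷ lift vectors
  ; independent = indep-∷ e₀∉lift (indep-lift independent)
  ; vanish      = λ { zero zero q0′ → contradiction (trans (sym q0) q0′) λ ()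
                    ; zero (suc i) _ → lookup-replicate i false
                    ; (suc j) → vanish-lift vectors vanish j }
  ; complete    = λ { (x₀ ∷ x) x-vanishes → head-and-lift x₀ (complete x (x-vanishes ∘ suc)) }
  }
  where
  open VanishingBasis B
  e₀ : V (suc n)
  e₀ = true ∷ zeroV
  e₀∉lift : ¬ InSpan (lift vectors) e₀
  e₀∉lift (c , eq) with trans (sym (lincomb-lift c vectors)) eq
  ... | ()
  head-and-lift : (x₀ : Bool) {x : V n} → InSpan vectors x → InSpan (e₀ ∷ lift vectors) (x₀ ∷ x)
  head-and-lift false x∈F = span-there (span-lift x∈F)
  head-and-lift true  (c , refl) = true ∷ c , (begin
    e₀ ⊕ lincomb c (lift vectors)      ≡⟨ cong (e₀ ⊕_) (lincomb-lift c vectors) ⟩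
    true ∷ (zeroV ⊕ lincomb c vectors) ≡⟨ cong (true ∷_) (⊕-identityˡ _) ⟩
    true ∷ lincomb c vectors           ∎)
    where open ≡-Reasoning

span-vanishes-at : (i : Fin n) {b : Vec (V n) k} → (∀ j → lookup (lookup b j) i ≡ false) →
  {y : V n} → InSpan b y → lookup y i ≡ false
span-vanishes-at i {[]}    _ ([] , refl) = lookup-replicate i false
span-vanishes-at i {v ∷ b} b-vanishes (false ∷ c , refl) = span-vanishes-at i (b-vanishes ∘ suc) (c , refl)
span-vanishes-at i {v ∷ b} b-vanishes (true ∷ c , refl) = begin
  lookup (v ⊕ lincomb c b) i            ≡⟨ lookup-⊕ v (lincomb c b) i ⟩
  lookup v i xor lookup (lincomb c b) i
    ≡⟨ cong₂ _xor_ (b-vanishes zero) (span-vanishes-at i (b-vanishes ∘ suc) (c , refl)) ⟩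
  false                                 ∎
  where open ≡-Reasoning

span-vanishes : {q : Fin n → Bool} {b : Vec (V n) k} → (∀ j → VanishesOn q (lookup b j)) →
  {y : V n} → InSpan b y → VanishesOn q y
span-vanishes b-vanishes y∈b i qi = span-vanishes-at i (λ j → b-vanishes j i qi) y∈b

OnesOn : (Fin n → Bool) → V n → Set
OnesOn q u = ∀ i → q i ≡ true → lookup u i ≡ true

𝟙 : V n
𝟙 = replicate _ true

𝟙-onesOn : (q : Fin n → Bool) → OnesOn q 𝟙
𝟙-onesOn q i _ = lookup-replicate i true

𝟙⊕-onesOn : {q : Fin n → Bool} {y : V n} → VanishesOn q y → OnesOn q (𝟙 ⊕ y)
𝟙⊕-onesOn {y = y} y-vanishes i qi =
  trans (lookup-⊕ 𝟙 y i) (cong₂ _xor_ (lookup-replicate i true) (y-vanishes i qi))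

⊕𝟙-vanishes : {q : Fin n → Bool} {u : V n} → OnesOn q u → VanishesOn q (u ⊕ 𝟙)
⊕𝟙-vanishes {u = u} u-ones i qi =
  trans (lookup-⊕ u 𝟙 i) (cong₂ _xor_ (u-ones i qi) (lookup-replicate i true))

𝟙-nonvanishing : {q : Fin n → Bool} {i : Fin n} → q i ≡ true → ¬ VanishesOn q 𝟙
𝟙-nonvanishing {i = i} qi 𝟙-vanishes with trans (sym (lookup-replicate i true)) (𝟙-vanishes i qi)
... | ()

vanishing-∉-span-∷ : {q : Fin n → Bool} {b : Vec (V n) k} {v y : V n} →
  (∀ j → VanishesOn q (lookup b j)) → ¬ VanishesOn q v → VanishesOn q y →
  ¬ InSpan b y → ¬ InSpan (v ∷ b) y
vanishing-∉-span-∷ b-vanishes v-nonvanishing y-vanishes y∉b y∈vb =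
  v-nonvanishing (span-vanishes (λ { zero → y-vanishes ; (suc j) → b-vanishes j })
                                (span-exchange y∈vb y∉b))

indep-𝟙⊕ : {q : Fin n → Bool} {i : Fin n} {b : Vec (V n) k} (y₁ y₂ : V n) → q i ≡ true →
  (∀ j → VanishesOn q (lookup b j)) → VanishesOn q y₁ → VanishesOn q y₂ →
  LinIndep (y₁ ∷ y₂ ∷ b) → LinIndep ((𝟙 ⊕ y₁) ∷ (𝟙 ⊕ y₂) ∷ 𝟙 ∷ b)
indep-𝟙⊕ {b = b} y₁ y₂ qi b-vanishes y₁-vanishes y₂-vanishes ind =
  indep-∷ (∉-span-⊕ (span-here 𝟙 _) y₁∉𝟙y₂b ∘ span-mono 𝟙⊕y₂∷𝟙b⊑𝟙y₂b)
    (indep-∷ (∉-span-⊕ (span-here 𝟙 b) y₂∉𝟙b)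
      (indep-∷ (𝟙-nonvanishing qi ∘ span-vanishes b-vanishes) (indep-tail (indep-tail ind))))
  where
  y₂b-vanishes : ∀ j → VanishesOn _ (lookup (y₂ ∷ b) j)
  y₂b-vanishes zero    = y₂-vanishes
  y₂b-vanishes (suc j) = b-vanishes j
  y₂∉𝟙b : ¬ InSpan (𝟙 ∷ b) y₂
  y₂∉𝟙b =
    vanishing-∉-span-∷ b-vanishes (𝟙-nonvanishing qi) y₂-vanishes (indep-head (indep-tail ind))
  y₁∉𝟙y₂b : ¬ InSpan (𝟙 ∷ y₂ ∷ b) y₁
  y₁∉𝟙y₂b = vanishing-∉-span-∷ y₂b-vanishes (𝟙-nonvanishing qi) y₁-vanishes (indep-head ind)
  𝟙⊕y₂∷𝟙b⊑𝟙y₂b : (𝟙 ⊕ y₂) ∷ 𝟙 ∷ b ⊑ 𝟙 ∷ y₂ ∷ b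
  𝟙⊕y₂∷𝟙b⊑𝟙y₂b = ⊑-∷ (span-⊕ (span-here 𝟙 _) (span-there (span-here y₂ b)))
                    (⊑-∷ (span-here 𝟙 _) (⊑-there {b = b} (⊑-there {b = b} (⊑-refl b))))

-- Counting degenerate coordinates

countᵇ-tabulate : {A : Set} (f : Fin n → A) (q : A → Bool) →
  length (filterᵇ q (tabulate f)) ≡ countᵇ (q ∘ f)
countᵇ-tabulate {zero}  f q = refl
countᵇ-tabulate {suc n} f q with q (f zero)
... | true  = cong suc (countᵇ-tabulate (f ∘ suc) q)
... | false = countᵇ-tabulate (f ∘ suc) q

countᵇ-complement : (q : Fin n → Bool) → countᵇ q + countᵇ (not ∘ q) ≡ n
countᵇ-complement {zero}  q = refl
countᵇ-complement {suc n} q with q zero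
... | true  = cong suc (countᵇ-complement (q ∘ suc))
... | false = trans (+-suc _ _) (cong suc (countᵇ-complement (q ∘ suc)))

countᵇ-all : (q : Fin n → Bool) → (∀ i → q i ≡ true) → countᵇ q ≡ n
countᵇ-all {zero}  q all-true = refl
countᵇ-all {suc n} q all-true rewrite all-true zero = cong suc (countᵇ-all (q ∘ suc) (all-true ∘ suc))

standard-basis : VanishingBasis {n} (λ _ → false) n
standard-basis = subst (VanishingBasis _) (countᵇ-all _ λ _ → refl) (vanishing-basis (λ _ → false))

∈-allVecs : (x : V n) → x ∈ allVecs n
∈-allVecs []               = here refl
∈-allVecs {suc n} (true ∷ x)  = ∈-++⁺ˡ (∈-map⁺ (true ∷_) (∈-allVecs x))
∈-allVecs {suc n} (false ∷ x) =
  ∈-++⁺ʳ (Data.List.map (true ∷_) (allVecs n)) (∈-map⁺ (false ∷_) (∈-allVecs x))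

foldr-∧-true⇔ : {A : Set} (f : A → Bool) (xs : List A) →
  foldr (λ x r → f x ∧ r) true xs ≡ true ⇔ (∀ x → x ∈ xs → f x ≡ true)
foldr-∧-true⇔ f xs = mk⇔ (⇒ xs) (⇐ xs)
  where
  ⇒ : ∀ xs → foldr (λ x r → f x ∧ r) true xs ≡ true → ∀ x → x ∈ xs → f x ≡ true
  ⇒ (y ∷ xs) all-y∷xs x x∈y∷xs with f y in fy | x∈y∷xs
  ... | true | here refl = fy
  ... | true | there x∈xs = ⇒ xs all-y∷xs x x∈xs
  ⇐ : ∀ xs → (∀ x → x ∈ xs → f x ≡ true) → foldr (λ x r → f x ∧ r) true xs ≡ true
  ⇐ []       _ = refl
  ⇐ (y ∷ xs) all-xs rewrite all-xs y (here refl) = ⇐ xs (λ x → all-xs x ∘ there)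

containedᵇ-reflects : (S : Sub n) (i : Fin n) → containedᵇ S i ≡ true ⇔ S ⊆ₛ C i
containedᵇ-reflects {n} S i = mk⇔ ⇒ ⇐
  where
  ⇒ : containedᵇ S i ≡ true → S ⊆ₛ C i
  ⇒ contained x Sx with to (foldr-∧-true⇔ _ (allVecs n)) contained x (∈-allVecs x)
  ... | holds rewrite Sx = holds
  ⇐ : S ⊆ₛ C i → containedᵇ S i ≡ true
  ⇐ S⊆Ci = from (foldr-∧-true⇔ _ (allVecs n)) λ x _ → holds x
    where
    holds : ∀ x → (not (S x) ∨ C i x) ≡ true
    holds x with S x in Sx
    ... | true  = S⊆Ci x Sx
    ... | false = refl

m≤m+n∸k∸1⇔k<n : (m n k : ℕ) → k < m + n → m ≤ m + n ∸ k ∸ 1 ⇔ k < n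
m≤m+n∸k∸1⇔k<n m n k k<m+n = mk⇔ ⇒ ⇐
  where
  ∸-suc : m + n ∸ k ∸ 1 ≡ m + n ∸ suc k
  ∸-suc = trans (∸-+-assoc (m + n) k 1) (cong (m + n ∸_) (+-comm k 1))
  ⇒ : m ≤ m + n ∸ k ∸ 1 → k < n
  ⇒ m≤ = +-cancelˡ-≤ m (suc k) n (m≤o∸n⇒m+n≤o m k<m+n (subst (m ≤_) ∸-suc m≤))
  ⇐ : k < n → m ≤ m + n ∸ k ∸ 1
  ⇐ k<n = subst (m ≤_) (sym ∸-suc) (m+n≤o⇒m≤o∸n m (+-monoʳ-≤ m k<n))

-- The star of S

module StarOf {n m : ℕ} {S : Sub n} (s₁ : V n) (r : Vec (V n) m)
              (s-indep : LinIndep (s₁ ∷ r)) (s-spans : Spans (s₁ ∷ r) S) where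

  s : Vec (V n) (suc m)
  s = s₁ ∷ r

  degenerate : Fin n → Bool
  degenerate = containedᵇ S

  Z : V n → Set
  Z = VanishesOn degenerate

  s-vanishes : ∀ j → Z (lookup s j)
  s-vanishes j i Si =
    not-injective (to (containedᵇ-reflects S i) Si (lookup s j) (from (s-spans _) (⊑-refl s j)))

  S⊆span∷ : {u : V n} {U : Sub n} → Spans (u ∷ s) U → S ⊆ₛ U
  S⊆span∷ u∷s-spans x x∈S = from (u∷s-spans x) (span-there (to (s-spans x) x∈S))

  nondeg⇔onesOn : {u : V n} {U : Sub n} → Spans (u ∷ s) U → NonDeg U ⇔ OnesOn degenerate u
  nondeg⇔onesOn {u} {U} u∷s-spans = mk⇔ ⇒ ⇐
    where
    ⇒ : NonDeg U → OnesOn degenerate u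
    ⇒ nondeg i Si with lookup u i in ui
    ... | true  = refl
    ... | false = contradiction U⊆Ci (nondeg i)
      where
      U⊆Ci : U ⊆ₛ C i
      U⊆Ci x x∈U = cong not (span-vanishes-at i (λ { zero → ui ; (suc j) → s-vanishes j i Si })
                                                 (to (u∷s-spans x) x∈U))
    ⇐ : OnesOn degenerate u → NonDeg U
    ⇐ u-ones i U⊆Ci with degenerate i in Si
    ... | true  with trans (sym (U⊆Ci u (from (u∷s-spans u) (span-here u s)))) (cong not (u-ones i Si))
    ...   | ()
    ⇐ u-ones i U⊆Ci | false
      with trans (sym (from (containedᵇ-reflects S i) λ x x∈S → U⊆Ci x (S⊆span∷ u∷s-spans x x∈S))) Si
    ...   | ()

  StarS : Sub n → Set
  StarS = Star S (2 + m)

  star-member : {u : V n} → ¬ InSpan s u → OnesOn degenerate u → StarS (spanᵇ (u ∷ s))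
  star-member {u} u∉s u-ones =
    ( (spanᵇ-hasDim (u ∷ s) (indep-∷ u∉s s-indep) , from (nondeg⇔onesOn (spanᵇ-spans (u ∷ s))) u-ones)
    , S⊆span∷ (spanᵇ-spans (u ∷ s)) )

  star-spanned : {U : Sub n} {u : V n} → StarS U → u ∈ₛ U → ¬ InSpan s u → Spans (u ∷ s) U
  star-spanned ((U-dim , _) , S⊆U) u∈U u∉s =
    indep-spans U-dim ≤-refl (indep-∷ u∉s s-indep)
      λ { zero → u∈U ; (suc j) → S⊆U _ (from (s-spans _) (⊑-refl s j)) }

  star-∃-spanned : {U : Sub n} → StarS U → ∃ λ u → ¬ InSpan s u × Spans (u ∷ s) U
  star-∃-spanned U∈star@((U-dim , _) , _) with ∃-∈-outside-span U-dim s ≤-refl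
  ... | u , u∈U , u∉s = u , u∉s , star-spanned U∈star u∈U u∉s

  star-isClique : IsClique (2 + m) StarS
  star-isClique U W U∈star W∈star U≉W = s , s-indep , λ x → mk⇔ (⇒ x) (⇐ x)
    where
    ⇒ : ∀ x → (U x ∧ W x) ≡ true → InSpan s x
    ⇒ x x∈U∩W with InSpan? s x | ∧-true⁻ x∈U∩W
    ... | yes x∈s | _ = x∈s
    ... | no x∉s  | x∈U , x∈W =
      contradiction (spans-unique (star-spanned U∈star x∈U x∉s) (star-spanned W∈star x∈W x∉s)) U≉W
    ⇐ : ∀ x → InSpan s x → (U x ∧ W x) ≡ true
    ⇐ x x∈s = ∧-true⁺ (proj₂ U∈star x x∈S) (proj₂ W∈star x x∈S)
      where
      x∈S : x ∈ₛ S
      x∈S = from (s-spans x) x∈s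

  Extension : Sub n → Set
  Extension W = Vertex (2 + m) W × ¬ StarS W × (∀ U → StarS U → Adj (2 + m) U W)

  meets-outside-S : {U W : Sub n} → Adj (2 + m) U W → ¬ S ⊆ₛ W →
    ∃ λ x → x ∈ₛ U × x ∈ₛ W × ¬ InSpan s x
  meets-outside-S (β , β-indep , β-spans) S⊈W with ⊑-or-outside β s
  ... | inj₂ (j , β[j]∉s) with ∧-true⁻ (from (β-spans _) (⊑-refl β j))
  ...   | β[j]∈U , β[j]∈W = lookup β j , β[j]∈U , β[j]∈W , β[j]∉s
  meets-outside-S (β , β-indep , β-spans) S⊈W | inj₁ β⊑s = contradiction S⊆W S⊈W
    where
    S⊆W : S ⊆ₛ _
    S⊆W x x∈S = proj₂ (∧-true⁻ (from (β-spans x)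
      (span-mono (indep-⊑-flip ≤-refl β-indep β⊑s) (to (s-spans x) x∈S))))

  -- W meets ⟨v₁, S⟩ and ⟨v₂, S⟩ outside S and ⟨v₃, S⟩ in a (k-1)-space: k + 1 independent vectors of W.
  meets-three-impossible : {v₁ v₂ v₃ : V n} {W : Sub n} → LinIndep (v₁ ∷ v₂ ∷ v₃ ∷ s) →
    HasDim W (2 + m) → ¬ S ⊆ₛ W → Adj (2 + m) (spanᵇ (v₁ ∷ s)) W →
    Adj (2 + m) (spanᵇ (v₂ ∷ s)) W → Adj (2 + m) (spanᵇ (v₃ ∷ s)) W → ⊥
  meets-three-impossible {v₁} {v₂} {v₃} ind (ω , ω-indep , ω-spans) S⊈W U₁∩W U₂∩W
                         (β , β-indep , β-spans)
    with meets-outside-S U₁∩W S⊈W | meets-outside-S U₂∩W S⊈W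
  ... | x₁ , x₁∈U₁ , x₁∈W , x₁∉s | x₂ , x₂∈U₂ , x₂∈W , x₂∉s =
    1+n≰n (indep-length-≤ family-indep family⊑ω)
    where
    β⊑v₃s : β ⊑ v₃ ∷ s
    β⊑v₃s j = to (spanᵇ-spans (v₃ ∷ s) _) (proj₁ (∧-true⁻ (from (β-spans _) (⊑-refl β j))))
    family-indep : LinIndep (x₁ ∷ x₂ ∷ β)
    family-indep = indep-from-exchange ind (to (spanᵇ-spans (v₁ ∷ s) x₁) x₁∈U₁) x₁∉s
                     (to (spanᵇ-spans (v₂ ∷ s) x₂) x₂∈U₂) x₂∉s β-indep β⊑v₃s
    family⊑ω : x₁ ∷ x₂ ∷ β ⊑ ω
    family⊑ω zero          = to (ω-spans x₁) x₁∈W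
    family⊑ω (suc zero)    = to (ω-spans x₂) x₂∈W
    family⊑ω (suc (suc j)) = to (ω-spans _) (proj₂ (∧-true⁻ (from (β-spans _) (⊑-refl β j))))

  no-extension-from : {v₁ v₂ v₃ : V n} → LinIndep (v₁ ∷ v₂ ∷ v₃ ∷ s) →
    OnesOn degenerate v₁ → OnesOn degenerate v₂ → OnesOn degenerate v₃ → ∀ W → ¬ Extension W
  no-extension-from ind ones₁ ones₂ ones₃ W (W-vertex , W∉star , adj) =
    meets-three-impossible ind (proj₁ W-vertex) (λ S⊆W → W∉star (W-vertex , S⊆W))
      (adj _ (star-member (indep-head ind ∘ span-there ∘ span-there) ones₁))
      (adj _ (star-member (indep-head (indep-tail ind) ∘ span-there) ones₂))
      (adj _ (star-member (indep-head (indep-tail (indep-tail ind))) ones₃))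

  N : ℕ
  N = countᵇ (not ∘ degenerate)

  open VanishingBasis (vanishing-basis degenerate) using (independent; vanish; complete)
    renaming (vectors to Z-basis)

  degenerate? : Dec (∃ λ i → degenerate i ≡ true)
  degenerate? = any? (λ i → degenerate i ≟ true)

  N≡n : ¬ (∃ λ i → degenerate i ≡ true) → N ≡ n
  N≡n nondegenerate = countᵇ-all _ all-nondegenerate
    where
    all-nondegenerate : ∀ i → not (degenerate i) ≡ true
    all-nondegenerate i with degenerate i in Si
    ... | true  = contradiction (i , Si) nondegenerate
    ... | false = refl

  no-extension-degenerate : (∃ λ i → degenerate i ≡ true) → 3 + m ≤ N → ∀ W → ¬ Extension W
  no-extension-degenerate (i , Si) 3+m≤N
    with extend-indep (≤-trans (n≤1+n _) 3+m≤N) independent s-indep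
  ... | j₂ , y₂s-indep with extend-indep 3+m≤N independent y₂s-indep
  ...   | j₁ , y₁y₂s-indep =
    no-extension-from
      (indep-𝟙⊕ (lookup Z-basis j₁) (lookup Z-basis j₂) Si s-vanishes (vanish j₁) (vanish j₂) y₁y₂s-indep)
      (𝟙⊕-onesOn (vanish j₁)) (𝟙⊕-onesOn (vanish j₂)) (𝟙-onesOn degenerate)

  no-extension-nondegenerate : ¬ (∃ λ i → degenerate i ≡ true) → 3 + m < N → ∀ W → ¬ Extension W
  no-extension-nondegenerate nondegenerate 3+m<N
    with extend-indep (≤-trans (n≤1+n _) (≤-trans (n≤1+n _) 3+m<N)) independent s-indep
  ... | j₃ , y₃s-indep with extend-indep (≤-trans (n≤1+n _) 3+m<N) independent y₃s-indep
  ...   | j₂ , y₂y₃s-indep with extend-indep 3+m<N independent y₂y₃s-indep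
  ...     | j₁ , y₁y₂y₃s-indep = no-extension-from y₁y₂y₃s-indep
    (vacuous (lookup Z-basis j₁)) (vacuous (lookup Z-basis j₂)) (vacuous (lookup Z-basis j₃))
    where
    vacuous : (v : V n) → OnesOn degenerate v
    vacuous v i Si = contradiction (i , Si) nondegenerate

  no-extension : 3 + m < n → 3 + m ≤ N → ∀ W → ¬ Extension W
  no-extension 3+m<n 3+m≤N with degenerate?
  ... | yes degenerate-i   = no-extension-degenerate degenerate-i 3+m≤N
  ... | no  nondegenerate =
    no-extension-nondegenerate nondegenerate (subst (3 + m <_) (sym (N≡n nondegenerate)) 3+m<n)

  ∃-direction : 3 + m < n → N ≤ 2 + m → (∃ λ i → degenerate i ≡ true) →
    ∃ λ w → ¬ InSpan (𝟙 ∷ s) w × (∀ x → Z x → InSpan (w ∷ s) x)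
  ∃-direction 3+m<n N≤2+m (i , Si) with ⊑-or-outside Z-basis s
  ... | inj₂ (j , y∉s) =
    y , vanishing-∉-span-∷ s-vanishes (𝟙-nonvanishing Si) (vanish j) y∉s ,
    λ x x∈Z → span-mono (indep-⊑-flip N≤2+m (indep-∷ y∉s s-indep) ys⊑Z-basis) (complete x x∈Z)
    where
    y : V n
    y = lookup Z-basis j
    ys⊑Z-basis : y ∷ s ⊑ Z-basis
    ys⊑Z-basis zero     = complete y (vanish j)
    ys⊑Z-basis (suc j′) = complete _ (s-vanishes j′)
  ... | inj₁ Z-basis⊑s
    with ∃-outside-span (VanishingBasis.vectors standard-basis) (𝟙 ∷ s) (≤-trans (n≤1+n _) 3+m<n)
                        (VanishingBasis.independent standard-basis)
  ...   | j , e∉𝟙s = _ , e∉𝟙s , λ x x∈Z → span-there (span-mono Z-basis⊑s (complete x x∈Z))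

  module ExtensionAlong {i : Fin n} (Si : degenerate i ≡ true) (w : V n) (w∉𝟙s : ¬ InSpan (𝟙 ∷ s) w)
                        (Z⊆ws : ∀ x → Z x → InSpan (w ∷ s) x) where

    W : Sub n
    W = spanᵇ (𝟙 ∷ w ∷ r)

    𝟙∉s : ¬ InSpan s 𝟙
    𝟙∉s = 𝟙-nonvanishing Si ∘ span-vanishes s-vanishes

    𝟙∉ws : ¬ InSpan (w ∷ s) 𝟙
    𝟙∉ws 𝟙∈ws = w∉𝟙s (span-exchange 𝟙∈ws 𝟙∉s)

    𝟙ws-indep : LinIndep (𝟙 ∷ w ∷ s₁ ∷ r)
    𝟙ws-indep = indep-∷ 𝟙∉ws (indep-∷ (w∉𝟙s ∘ span-there) s-indep)

    W-vertex : Vertex (2 + m) W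
    W-vertex = spanᵇ-hasDim (𝟙 ∷ w ∷ r) 𝟙wr-indep , 𝟙∈W⇒nondeg
      where
      𝟙wr-indep : LinIndep (𝟙 ∷ w ∷ r)
      𝟙wr-indep =
        indep-∷ (𝟙∉ws ∘ span-skip) (indep-∷ (w∉𝟙s ∘ span-there ∘ span-there) (indep-tail s-indep))
      𝟙∈W⇒nondeg : NonDeg W
      𝟙∈W⇒nondeg i W⊆Ci
        with trans (sym (W⊆Ci 𝟙 (from (spanᵇ-spans (𝟙 ∷ w ∷ r) 𝟙) (span-here 𝟙 _))))
                   (cong not (lookup-replicate i true))
      ... | ()

    W∉star : ¬ StarS W
    W∉star (_ , S⊆W) = 𝟙∉s (span-exchange s₁∈𝟙r (indep-head s-indep))
      where
      s₁∈𝟙r : InSpan (𝟙 ∷ r) s₁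
      s₁∈𝟙r = span-∩ 𝟙ws-indep
                (to (spanᵇ-spans (𝟙 ∷ w ∷ r) s₁) (S⊆W s₁ (from (s-spans s₁) (span-here s₁ r))))
                (span-there (span-here s₁ r))

    meet : {U : Sub n} {u : V n} (ε : Bool) (R : Vec Bool (suc m)) → Spans (u ∷ s) U →
      scale ε w ⊕ lincomb R s ≡ u ⊕ 𝟙 → Adj (2 + m) U W
    meet {U} {u} ε R u-spans u⊕𝟙≡ =
      a ∷ r , indep-skip (indep-skip a-indep) , λ x → mk⇔ (⇒ x) (⇐ x)
      where
      a σ : V n
      a = 𝟙 ⊕ scale ε w
      σ = lincomb R s
      u≡a⊕σ : u ≡ a ⊕ σ
      u≡a⊕σ = begin
        u                   ≡⟨ ⊕-cancelˡ 𝟙 u ⟨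
        𝟙 ⊕ (𝟙 ⊕ u)         ≡⟨ cong (𝟙 ⊕_) (⊕-comm 𝟙 u) ⟩
        𝟙 ⊕ (u ⊕ 𝟙)         ≡⟨ cong (𝟙 ⊕_) u⊕𝟙≡ ⟨
        𝟙 ⊕ (scale ε w ⊕ σ) ≡⟨ ⊕-assoc 𝟙 (scale ε w) σ ⟨
        a ⊕ σ               ∎
        where open ≡-Reasoning
      εw∈wr : ∀ {l} (t : Vec (V n) l) → InSpan (w ∷ t) (scale ε w)
      εw∈wr t = span-scale-here ε w t
      a-indep : LinIndep (a ∷ w ∷ s₁ ∷ r)
      a-indep = indep-⊕-head 𝟙ws-indep (εw∈wr s)
      r⊑s : r ⊑ s
      r⊑s = ⊑-there {b = r} (⊑-refl r)
      ⇒ : ∀ x → (U x ∧ W x) ≡ true → InSpan (a ∷ r) x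
      ⇒ x x∈U∩W = span-∩ a-indep
        (span-mono 𝟙wr⊑awr (to (spanᵇ-spans (𝟙 ∷ w ∷ r) x) (proj₂ (∧-true⁻ x∈U∩W))))
        (span-mono us⊑as (to (u-spans x) (proj₁ (∧-true⁻ x∈U∩W))))
        where
        𝟙wr⊑awr : 𝟙 ∷ w ∷ r ⊑ a ∷ w ∷ r
        𝟙wr⊑awr = ⊑-∷ (subst (InSpan _) (⊕-cancelʳ 𝟙 (scale ε w))
                              (span-⊕ (span-here a _) (span-there (εw∈wr r))))
                      (⊑-there {b = w ∷ r} (⊑-refl (w ∷ r)))
        us⊑as : u ∷ s ⊑ a ∷ s
        us⊑as = ⊑-∷ (subst (InSpan _) (sym u≡a⊕σ) (span-⊕ (span-here a s) (span-there (R , refl))))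
                    (⊑-there {b = s} (⊑-refl s))
      ⇐ : ∀ x → InSpan (a ∷ r) x → (U x ∧ W x) ≡ true
      ⇐ x x∈ar = ∧-true⁺ (from (u-spans x) (span-mono ar⊑us x∈ar))
                         (from (spanᵇ-spans (𝟙 ∷ w ∷ r) x) (span-mono ar⊑𝟙wr x∈ar))
        where
        ar⊑us : a ∷ r ⊑ u ∷ s
        ar⊑us = ⊑-∷ (subst (InSpan _) (trans (cong (_⊕ σ) u≡a⊕σ) (⊕-cancelʳ a σ))
                        (span-⊕ (span-here u s) (span-there (R , refl))))
                    (⊑-there {b = r} r⊑s)
        ar⊑𝟙wr : a ∷ r ⊑ 𝟙 ∷ w ∷ r
        ar⊑𝟙wr = ⊑-∷ (span-⊕ (span-here 𝟙 _) (span-there (εw∈wr r)))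
                     (⊑-there {b = r} (⊑-there {b = r} (⊑-refl r)))

    adjacent : ∀ U → StarS U → Adj (2 + m) U W
    adjacent U U∈star with star-∃-spanned U∈star
    ... | u , u∉s , u-spans
      with Z⊆ws (u ⊕ 𝟙) (⊕𝟙-vanishes {u = u} (to (nondeg⇔onesOn {u} u-spans) (proj₂ (proj₁ U∈star))))
    ...   | ε ∷ R , u⊕𝟙≡ = meet ε R u-spans (trans (sym (lincomb-∷ ε R w s)) u⊕𝟙≡)

    extension : Extension W
    extension = W-vertex , W∉star , adjacent

  c+N≡n : c S + N ≡ n
  c+N≡n = trans (cong (_+ N) (countᵇ-tabulate (λ i → i) degenerate)) (countᵇ-complement degenerate)

  c≤⇔ : 3 + m < n → c S ≤ n ∸ (2 + m) ∸ 1 ⇔ 3 + m ≤ N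
  c≤⇔ 3+m<n = subst (λ n′ → c S ≤ n′ ∸ (2 + m) ∸ 1 ⇔ 3 + m ≤ N) c+N≡n
    (m≤m+n∸k∸1⇔k<n (c S) N (2 + m) (subst (3 + m ≤_) (sym c+N≡n) (<⇒≤ 3+m<n)))

  isMaximal⇔ : 3 + m < n → IsMaximalClique (2 + m) StarS ⇔ 3 + m ≤ N
  isMaximal⇔ 3+m<n = mk⇔ ⇒ ⇐
    where
    ⇐ : 3 + m ≤ N → IsMaximalClique (2 + m) StarS
    ⇐ 3+m≤N = star-isClique , λ (W , W-extends) → no-extension 3+m<n 3+m≤N W W-extends
    ⇒ : IsMaximalClique (2 + m) StarS → 3 + m ≤ N
    ⇒ (_ , maximal) with 3 + m ≤? N | degenerate?
    ... | yes 3+m≤N | _                = 3+m≤N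
    ... | no 3+m≰N  | no nondegenerate =
      contradiction (subst (3 + m ≤_) (sym (N≡n nondegenerate)) (<⇒≤ 3+m<n)) 3+m≰N
    ... | no 3+m≰N  | yes degenerate-i with ∃-direction 3+m<n (≤-pred (≰⇒> 3+m≰N)) degenerate-i
    ...   | w , w∉𝟙s , Z⊆ws = contradiction (W , extension) maximal
      where open ExtensionAlong (proj₂ degenerate-i) w w∉𝟙s Z⊆ws

proposition2 : (n k : ℕ) → 1 < k → suc k < n → (S : Sub n) → HasDim S (k ∸ 1) →
    (IsMaximalClique k (Star S k) ⇔ c S ≤ n ∸ k ∸ 1)
proposition2 n (suc (suc m)) (s≤s (s≤s z≤n)) 3+m<n S (s₁ ∷ r , s-indep , s-spans) =
  ⇔-sym (c≤⇔ 3+m<n) ⇔-∘ isMaximal⇔ 3+m<n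
  where open StarOf s₁ r s-indep s-spans
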